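{- For $n\ge1$ let $Q_n(x,z)=\sum_{\sigma\in\mathcal{S}_n}x^{\overrightarrow{des}_O(\sigma)}z^{\chi(\sigma_1\text{ odd})}$. Then (1) $Q_1(x,z)=z$ and $Q_2(x,z)=z+x$; (2) for all $n\ge1$, $Q_{2n+1}(x,z)=\Phi_{2n}(Q_{2n}(x,z))$; (3) for all $n\ge1$, $Q_{2n+2}(x,z)=\Psi_{2n+1}(Q_{2n+1}(x,z))$, where $\Phi_{2n}$ is the linear operator (on polynomials of degree at most 1 in $z$) sending $z^0x^k\mapsto z^1x^k+(n+k)z^0x^k+(n-k)z^0x^{k+1}$ and $z^1x^k\mapsto (n+k+1)z^1x^k+(n-k)z^1x^{k+1}$, and $\Psi_{2n+1}$ is the linear operator sending $z^0x^k\mapsto (n+k+1)z^0x^k+(n-k+1)z^0x^{k+1}$ and $z^1x^k\mapsto (n+k+1)z^1x^k+z^0x^{k+1}+(n-k)z^1x^{k+1}$.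
   Context: $\mathcal{S}_n$ denotes the set of permutations $\sigma=\sigma_1\cdots\sigma_n$ of $\{1,\dots,n\}$. $\overrightarrow{des}_O(\sigma)$ is the number of indices $i\in\{1,\dots,n-1\}$ with $\sigma_i>\sigma_{i+1}$ and $\sigma_{i+1}$ odd. $\chi(\sigma_1\text{ odd})$ is $1$ if $\sigma_1$ is odd and $0$ otherwise. -}

module Defs where

open import Data.Nat using (ℕ; zero; suc; _+_; _*_; _<ᵇ_)
open import Data.Nat.Properties using (_≟_)
open import Data.Nat.Base using (_%_)
open import Data.Bool using (Bool; true; false; if_then_else_)
open import Data.List using (List; []; _∷_; map; concatMap; length; filter)
open import Data.List.Relation.Unary.Unique.DecPropositional _≟_ using (Unique; unique?)
open import Data.Integer as ℤ using (ℤ; +_; _-_)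

oneTo : ℕ → List ℕ
oneTo zero = []
oneTo (suc n) = oneTo n Data.List.++ (suc n ∷ [])

words : List ℕ → ℕ → List (List ℕ)
words A zero = [] ∷ []
words A (suc m) = concatMap (λ a → map (a ∷_) (words A m)) A

S : ℕ → List (List ℕ)
S n = filter unique? (words (oneTo n) n)

odd : ℕ → Bool
odd m = (m % 2) Data.Nat.≡ᵇ 1

desO : List ℕ → ℕ
desO [] = 0
desO (a ∷ []) = 0
desO (a ∷ b ∷ rest) =
  (if (b <ᵇ a) Data.Bool.∧ odd b then 1 else 0) + desO (b ∷ rest)

χfirstOdd : List ℕ → ℕ
χfirstOdd [] = 0
χfirstOdd (a ∷ _) = if odd a then 1 else 0

-- Polynomials in x, z with integer coefficients, given by their
-- coefficient function:  P j k  = coefficient of  z^j x^k.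

Poly : Set
Poly = ℕ → ℕ → ℤ

_+P_ : Poly → Poly → Poly
(P +P R) j k = P j k ℤ.+ R j k

mono : ℕ → ℕ → Poly
mono a b j k = if (a Data.Nat.≡ᵇ j) Data.Bool.∧ (b Data.Nat.≡ᵇ k) then + 1 else + 0

zP xP : Poly
zP = mono 1 0
xP = mono 0 1

count : (List ℕ → Bool) → List (List ℕ) → ℕ
count p [] = 0
count p (σ ∷ σs) = (if p σ then 1 else 0) + count p σs

Q : ℕ → Poly
Q n j k = + count (λ σ → (χfirstOdd σ Data.Nat.≡ᵇ j) Data.Bool.∧ (desO σ Data.Nat.≡ᵇ k)) (S n)

-- The operators, as the linear extensions of their action on monomials
-- z^j x^k (j ∈ {0,1}), written coefficientwise.  Coefficients (n-k) are
-- computed in ℤ.  `prev P j k` is the coefficient of z^j x^(k-1)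
-- (zero when k = 0).

prev : Poly → ℕ → ℕ → ℤ
prev P j zero = + 0
prev P j (suc k) = P j k

Φ : ℕ → Poly → Poly
Φ n P zero k =
  (+ (n + k)) ℤ.* P 0 k
  ℤ.+ (+ n - (+ k - + 1)) ℤ.* prev P 0 k
Φ n P (suc zero) k =
  P 0 k
  ℤ.+ (+ (n + k + 1)) ℤ.* P 1 k
  ℤ.+ (+ n - (+ k - + 1)) ℤ.* prev P 1 k
Φ n P (suc (suc j)) k = + 0

Ψ : ℕ → Poly → Poly
Ψ n P zero k =
  (+ (n + k + 1)) ℤ.* P 0 k
  ℤ.+ (+ n - (+ k - + 1) ℤ.+ + 1) ℤ.* prev P 0 k
  ℤ.+ prev P 1 k
Ψ n P (suc zero) k =
  (+ (n + k + 1)) ℤ.* P 1 k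
  ℤ.+ (+ n - (+ k - + 1)) ℤ.* prev P 1 k
Ψ n P (suc (suc j)) k = + 0

-- Every permutation of {1, …, N + 1} arises exactly once by inserting the letter
-- N + 1 into one of the N + 1 slots of a permutation τ of {1, …, N}. Inserted in
-- front, it becomes the first letter and creates a descent onto τ₁, counted by desO
-- exactly when τ₁ is odd. Inserted at the end it changes nothing; inserted directly
-- before a later letter z, it raises desO by one exactly when z is odd and the pair
-- ending at z was not already a descent. Every odd descent ends at one of the
-- o − χ(τ₁ odd) odd letters after the first, so o − χ(τ₁ odd) − desO(τ) slots raise
-- desO and the remaining N − o + χ(τ₁ odd) + desO(τ) keep it. On generating
-- polynomials this is a linear operator depending only on N, the number o of odd
-- letters in {1, …, N} and the parity of N + 1; Φ_{2n} and Ψ_{2n+1} are its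
-- instances N = 2n and N = 2n + 1.

module Submission where

open import Defs
open import Data.Bool using (Bool; true; false; T; if_then_else_; _∧_)
open import Data.Bool.Properties using (∧-zeroʳ; T-∧; T-≡)
open import Data.Integer as ℤ using (ℤ; +_)
import Data.Integer.Properties as ℤₚ
open import Algebra.Properties.AbelianGroup ℤₚ.+-0-abelianGroup using (identityʳ-unique)
open import Data.Integer.Tactic.RingSolver using (solve-∀)
open import Data.List using (List; []; _∷_; [_]; _++_; map; concatMap; length; filter)
open import Data.List.Properties
  using (∷-injectiveˡ; ∷-injectiveʳ; ++-identityʳ; filter-all; filter-accept; filter-reject)
open import Data.List.Membership.Propositional using (_∈_; _∉_; find; lose)
open import Data.List.Membership.Propositional.Properties
  using ( ∈-++⁻; ∈-++⁺ʳ; ∈-∃++; ∈-map⁺; ∈-map⁻; ∈-concatMap⁺; ∈-concatMap⁻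
        ; ∈-filter⁺; ∈-filter⁻)
open import Data.List.Membership.Propositional.Properties.WithK using (unique∧set⇒bag)
open import Data.List.Relation.Binary.BagAndSetEquality using (∼bag⇒↭)
open import Data.List.Relation.Binary.Permutation.Propositional
  using (_↭_; ↭-refl; ↭-reflexive; ↭-sym; ↭-trans; ↭-prep; ↭-swap; ↭⇒↭ₛ)
open import Data.List.Relation.Binary.Permutation.Propositional.Properties
  using (map⁺; ∈-resp-↭; ↭-length; shift; drop-mid; ∷↭∷ʳ)
open import Data.List.Relation.Binary.Subset.Propositional using (_⊆_)
open import Data.List.Relation.Unary.All as All using (All; []; _∷_)
open import Data.List.Relation.Unary.All.Properties using (¬Any⇒All¬)
open import Data.List.Relation.Unary.AllPairs using ([]; _∷_)
open import Data.List.Relation.Unary.Any using (here; there)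
open import Data.List.Relation.Unary.Unique.Propositional using (Unique)
import Data.List.Relation.Unary.Unique.Propositional.Properties as Unique
open import Data.Nat using (ℕ; zero; suc; _+_; _*_; _≤_; _<_; z≤n; s≤s; _≡ᵇ_; _<ᵇ_)
open import Data.Nat.ListAction using (sum)
open import Data.Nat.ListAction.Properties using (sum-↭)
open import Data.Nat.Properties
  using ( _≟_; +-assoc; +-comm; *-suc; suc-injective; ≡ᵇ⇒≡; <ᵇ⇒<; <⇒<ᵇ; <⇒≯
        ; ≤-refl; ≤-reflexive; ≤-trans; <-irrefl; m≤n⇒m≤1+n; module ≤-Reasoning)
open import Data.List.Membership.DecPropositional _≟_ using (_∈?_)
open import Data.List.Relation.Unary.Unique.DecPropositional _≟_ using (unique?)
open import Data.Product using (_×_; _,_)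
open import Data.Sum using (inj₁; inj₂)
open import Function using (_∘_; Equivalence; mk⇔)
open import Relation.Binary.PropositionalEquality
  using (_≡_; _≢_; refl; sym; trans; cong; cong₂; subst; setoid; module ≡-Reasoning)
open import Data.List.Relation.Binary.Permutation.Setoid.Properties (setoid ℕ)
  using (Unique-resp-↭)
open import Relation.Nullary using (¬_; ¬?; yes; no; contradiction)

𝟙 : Bool → ℕ
𝟙 b = if b then 1 else 0

⟦_⟧ : Bool → ℤ
⟦ b ⟧ = if b then + 1 else + 0

+𝟙≡⟦⟧ : ∀ b → + 𝟙 b ≡ ⟦ b ⟧
+𝟙≡⟦⟧ false = refl
+𝟙≡⟦⟧ true  = refl

count-++ : ∀ (p : List ℕ → Bool) xs ys → count p (xs ++ ys) ≡ count p xs + count p ys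
count-++ p []       ys = refl
count-++ p (x ∷ xs) ys =
  trans (cong (_+_ (𝟙 (p x))) (count-++ p xs ys)) (sym (+-assoc (𝟙 (p x)) _ _))

count-map : ∀ (p : List ℕ → Bool) f xs → count p (map f xs) ≡ count (p ∘ f) xs
count-map p f []       = refl
count-map p f (x ∷ xs) = cong (_+_ (𝟙 (p (f x)))) (count-map p f xs)

count≡sum : ∀ (p : List ℕ → Bool) xs → count p xs ≡ sum (map (𝟙 ∘ p) xs)
count≡sum p []       = refl
count≡sum p (x ∷ xs) = cong (_+_ (𝟙 (p x))) (count≡sum p xs)

count-↭ : ∀ (p : List ℕ → Bool) {xs ys} → xs ↭ ys → count p xs ≡ count p ys
count-↭ p {xs} {ys} xs↭ys = begin
  count p xs             ≡⟨ count≡sum p xs ⟩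
  sum (map (𝟙 ∘ p) xs)   ≡⟨ sum-↭ (map⁺ (𝟙 ∘ p) xs↭ys) ⟩
  sum (map (𝟙 ∘ p) ys)   ≡⟨ count≡sum p ys ⟨
  count p ys             ∎
  where open ≡-Reasoning

oddCount : List ℕ → ℕ
oddCount xs = sum (map (𝟙 ∘ odd) xs)

oddCount-↭ : ∀ {xs ys} → xs ↭ ys → oddCount xs ≡ oddCount ys
oddCount-↭ xs↭ys = sum-↭ (map⁺ (𝟙 ∘ odd) xs↭ys)

infix 4 _≈P_

_≈P_ : Poly → Poly → Set
P ≈P R = ∀ j k → P j k ≡ R j k

0P : Poly
0P j k = + 0

genPoly : List (List ℕ) → Poly
genPoly L j k = + count (λ σ → (χfirstOdd σ ≡ᵇ j) ∧ (desO σ ≡ᵇ k)) L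

genPoly-∷ : ∀ σ L → genPoly (σ ∷ L) ≈P mono (χfirstOdd σ) (desO σ) +P genPoly L
genPoly-∷ σ L j k = cong (ℤ._+ genPoly L j k) (+𝟙≡⟦⟧ _)

genPoly-++ : ∀ L M → genPoly (L ++ M) ≈P genPoly L +P genPoly M
genPoly-++ L M j k = cong +_ (count-++ _ L M)

genPoly-↭ : ∀ {L M} → L ↭ M → genPoly L ≈P genPoly M
genPoly-↭ L↭M j k = cong +_ (count-↭ _ L↭M)

mono-weight : ∀ (w : ℕ → ℕ → ℤ) a d j k → w j k ℤ.* mono a d j k ≡ w a d ℤ.* mono a d j k
mono-weight w a d j k with (a ≡ᵇ j) ∧ (d ≡ᵇ k) in eq
... | true  with a≡ᵇj , d≡ᵇk ← Equivalence.to T-∧ (subst T (sym eq) _) =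
  cong₂ (λ j′ k′ → w j′ k′ ℤ.* + 1) (sym (≡ᵇ⇒≡ a j a≡ᵇj)) (sym (≡ᵇ⇒≡ d k d≡ᵇk))
... | false = trans (ℤₚ.*-zeroʳ (w j k)) (sym (ℤₚ.*-zeroʳ (w a d)))

prev-mono : ∀ a d j k → prev (mono a d) j k ≡ mono a (suc d) j k
prev-mono a d j zero    = cong ⟦_⟧ (sym (∧-zeroʳ (a ≡ᵇ j)))
prev-mono a d j (suc k) = refl

mono-diagonal : ∀ {a} d k → a ≤ 1 → mono a d 0 k ℤ.+ mono a (suc d) 1 k ≡ mono 0 (a + d) 0 k
mono-diagonal d k z≤n       = ℤₚ.+-identityʳ _
mono-diagonal d k (s≤s z≤n) = ℤₚ.+-identityˡ _

mono-raiseZ : ∀ b e j k → ⟦ b ≡ᵇ j ⟧ ℤ.* mono 0 e 0 k ≡ mono b e j k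
mono-raiseZ b e j k with b ≡ᵇ j
... | true  = ℤₚ.*-identityˡ _
... | false = refl

mono-high : ∀ {a} d j k → a ≤ 1 → mono a d (2 + j) k ≡ + 0
mono-high d j k z≤n       = refl
mono-high d j k (s≤s z≤n) = refl

DegreeZ≤1 : Poly → Set
DegreeZ≤1 P = ∀ j k → P (2 + j) k ≡ + 0

χfirstOdd≤1 : ∀ σ → χfirstOdd σ ≤ 1
χfirstOdd≤1 []      = z≤n
χfirstOdd≤1 (a ∷ _) with odd a
... | false = z≤n
... | true  = s≤s z≤n

genPoly-degreeZ≤1 : ∀ L → DegreeZ≤1 (genPoly L)
genPoly-degreeZ≤1 []      j k = refl
genPoly-degreeZ≤1 (σ ∷ L) j k =
  trans (genPoly-∷ σ L (2 + j) k)
        (cong₂ ℤ._+_ (mono-high (desO σ) j k (χfirstOdd≤1 σ)) (genPoly-degreeZ≤1 L j k))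

prev-degreeZ≤1 : ∀ {P} → DegreeZ≤1 P → DegreeZ≤1 (prev P)
prev-degreeZ≤1 P-deg j zero    = refl
prev-degreeZ≤1 P-deg j (suc k) = P-deg j k

-- The insertion operator

keepWeight : ℕ → ℕ → ℕ → ℕ → ℤ
keepWeight N o j k = + N ℤ.- + o ℤ.+ + j ℤ.+ + k

riseWeight : ℕ → ℕ → ℕ → ℤ
riseWeight o j k = + o ℤ.- + j ℤ.- (+ k ℤ.- + 1)

-- Inserting the letter N + 1 into permutations of {1, …, N} with o odd letters;
-- b = 1 if N + 1 is odd and b = 0 otherwise.
insertOp : (N o b : ℕ) → Poly → Poly
insertOp N o b P j k =
  ⟦ b ≡ᵇ j ⟧ ℤ.* (P 0 k ℤ.+ prev P 1 k)
  ℤ.+ keepWeight N o j k ℤ.* P j k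
  ℤ.+ riseWeight o j k ℤ.* prev P j k

insertOp-mono : ∀ N o b {a} d → a ≤ 1 →
  insertOp N o b (mono a d) ≈P λ j k →
    mono b (a + d) j k
    ℤ.+ keepWeight N o a d ℤ.* mono a d j k
    ℤ.+ riseWeight o a (suc d) ℤ.* mono a (suc d) j k
insertOp-mono N o b {a} d a≤1 j k = cong₂ ℤ._+_ (cong₂ ℤ._+_ new keep) rise
  where
  new : ⟦ b ≡ᵇ j ⟧ ℤ.* (mono a d 0 k ℤ.+ prev (mono a d) 1 k) ≡ mono b (a + d) j k
  new = trans (cong (λ x → ⟦ b ≡ᵇ j ⟧ ℤ.* (mono a d 0 k ℤ.+ x)) (prev-mono a d 1 k))
          (trans (cong (⟦ b ≡ᵇ j ⟧ ℤ.*_) (mono-diagonal d k a≤1)) (mono-raiseZ b (a + d) j k))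
  keep : keepWeight N o j k ℤ.* mono a d j k ≡ keepWeight N o a d ℤ.* mono a d j k
  keep = mono-weight (keepWeight N o) a d j k
  rise : riseWeight o j k ℤ.* prev (mono a d) j k ≡ riseWeight o a (suc d) ℤ.* mono a (suc d) j k
  rise = trans (cong (riseWeight o j k ℤ.*_) (prev-mono a d j k)) (mono-weight (riseWeight o) a (suc d) j k)

Additive : (Poly → Poly) → Set
Additive Op = ∀ {P A B} → P ≈P A +P B → Op P ≈P Op A +P Op B

Additive⇒zero : ∀ {Op} → Additive Op → Op 0P ≈P 0P
Additive⇒zero {Op} additive j k =
  identityʳ-unique (Op 0P j k) (Op 0P j k) (sym (additive (λ _ _ → refl) j k))

prev-additive : ∀ {P A B} → P ≈P A +P B → prev P ≈P prev A +P prev B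
prev-additive P≈A+B j zero    = refl
prev-additive P≈A+B j (suc k) = P≈A+B j k

insertOp-additive : ∀ N o b → Additive (insertOp N o b)
insertOp-additive N o b {P} {A} {B} P≈A+B j k
  rewrite P≈A+B 0 k | P≈A+B j k | prev-additive P≈A+B 1 k | prev-additive P≈A+B j k =
  linear ⟦ b ≡ᵇ j ⟧ (keepWeight N o j k) (riseWeight o j k)
    (A 0 k) (B 0 k) (prev A 1 k) (prev B 1 k) (A j k) (B j k) (prev A j k) (prev B j k)
  where
  linear : ∀ c₁ c₂ c₃ a₀ b₀ a₁ b₁ a₂ b₂ a₃ b₃ →
    c₁ ℤ.* ((a₀ ℤ.+ b₀) ℤ.+ (a₁ ℤ.+ b₁)) ℤ.+ c₂ ℤ.* (a₂ ℤ.+ b₂) ℤ.+ c₃ ℤ.* (a₃ ℤ.+ b₃)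
    ≡ (c₁ ℤ.* (a₀ ℤ.+ a₁) ℤ.+ c₂ ℤ.* a₂ ℤ.+ c₃ ℤ.* a₃)
      ℤ.+ (c₁ ℤ.* (b₀ ℤ.+ b₁) ℤ.+ c₂ ℤ.* b₂ ℤ.+ c₃ ℤ.* b₃)
  linear = solve-∀

genPoly-concatMap : ∀ {Op} → Additive Op → (f : List ℕ → List (List ℕ)) → ∀ L →
  (∀ {τ} → τ ∈ L → genPoly (f τ) ≈P Op (mono (χfirstOdd τ) (desO τ))) →
  genPoly (concatMap f L) ≈P Op (genPoly L)
genPoly-concatMap additive f []      _       j k = sym (Additive⇒zero additive j k)
genPoly-concatMap {Op} additive f (τ ∷ L) realise j k = begin
  genPoly (f τ ++ concatMap f L) j k
    ≡⟨ genPoly-++ (f τ) (concatMap f L) j k ⟩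
  genPoly (f τ) j k ℤ.+ genPoly (concatMap f L) j k
    ≡⟨ cong₂ ℤ._+_ (realise (here refl) j k) (genPoly-concatMap additive f L (realise ∘ there) j k) ⟩
  Op (mono (χfirstOdd τ) (desO τ)) j k ℤ.+ Op (genPoly L) j k
    ≡⟨ additive (genPoly-∷ τ L) j k ⟨
  Op (genPoly (τ ∷ L)) j k ∎
  where open ≡-Reasoning

insertOp-degreeZ≤1 : ∀ N o {b P} → b ≤ 1 → DegreeZ≤1 P → DegreeZ≤1 (insertOp N o b P)
insertOp-degreeZ≤1 N o {b} {P} b≤1 P-deg j k = begin
  c ℤ.* x ℤ.+ u ℤ.* P (2 + j) k ℤ.+ v ℤ.* prev P (2 + j) k
    ≡⟨ cong₂ (λ y y′ → c ℤ.* x ℤ.+ u ℤ.* y ℤ.+ v ℤ.* y′) (P-deg j k) (prev-degreeZ≤1 P-deg j k) ⟩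
  c ℤ.* x ℤ.+ u ℤ.* + 0 ℤ.+ v ℤ.* + 0
    ≡⟨ drop-zeros c x u v ⟩
  c ℤ.* x
    ≡⟨ cong (ℤ._* x) (b≢2+j b≤1) ⟩
  + 0 ∎
  where
  open ≡-Reasoning
  c x u v : ℤ
  c = ⟦ b ≡ᵇ 2 + j ⟧
  x = P 0 k ℤ.+ prev P 1 k
  u = keepWeight N o (2 + j) k
  v = riseWeight o (2 + j) k
  b≢2+j : ∀ {b} → b ≤ 1 → ⟦ b ≡ᵇ 2 + j ⟧ ≡ + 0
  b≢2+j z≤n       = refl
  b≢2+j (s≤s z≤n) = refl
  drop-zeros : ∀ c x u v → c ℤ.* x ℤ.+ u ℤ.* + 0 ℤ.+ v ℤ.* + 0 ≡ c ℤ.* x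
  drop-zeros = solve-∀

Φ≈insertOp : ∀ n {P} → DegreeZ≤1 P → Φ n P ≈P insertOp (2 * n) n 1 P
Φ≈insertOp n {P} P-deg zero k = coeff₀ (+ n) (+ k) (P 0 k) (prev P 0 k) (prev P 1 k)
  where
  coeff₀ : ∀ n k x x′ y′ →
    (n ℤ.+ k) ℤ.* x ℤ.+ (n ℤ.- (k ℤ.- + 1)) ℤ.* x′
    ≡ + 0 ℤ.* (x ℤ.+ y′) ℤ.+ (n ℤ.+ (n ℤ.+ + 0) ℤ.- n ℤ.+ + 0 ℤ.+ k) ℤ.* x
      ℤ.+ (n ℤ.- + 0 ℤ.- (k ℤ.- + 1)) ℤ.* x′
  coeff₀ = solve-∀
Φ≈insertOp n {P} P-deg (suc zero) k = coeff₁ (+ n) (+ k) (P 0 k) (P 1 k) (prev P 1 k)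
  where
  coeff₁ : ∀ n k x y y′ →
    x ℤ.+ (n ℤ.+ k ℤ.+ + 1) ℤ.* y ℤ.+ (n ℤ.- (k ℤ.- + 1)) ℤ.* y′
    ≡ + 1 ℤ.* (x ℤ.+ y′) ℤ.+ (n ℤ.+ (n ℤ.+ + 0) ℤ.- n ℤ.+ + 1 ℤ.+ k) ℤ.* y
      ℤ.+ (n ℤ.- + 1 ℤ.- (k ℤ.- + 1)) ℤ.* y′
  coeff₁ = solve-∀
Φ≈insertOp n P-deg (suc (suc j)) k = sym (insertOp-degreeZ≤1 (2 * n) n (s≤s z≤n) P-deg j k)

Ψ≈insertOp : ∀ n {P} → DegreeZ≤1 P → Ψ n P ≈P insertOp (suc (2 * n)) (suc n) 0 P
Ψ≈insertOp n {P} P-deg zero k = coeff₀ (+ n) (+ k) (P 0 k) (prev P 0 k) (prev P 1 k)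
  where
  coeff₀ : ∀ n k x x′ y′ →
    (n ℤ.+ k ℤ.+ + 1) ℤ.* x ℤ.+ (n ℤ.- (k ℤ.- + 1) ℤ.+ + 1) ℤ.* x′ ℤ.+ y′
    ≡ + 1 ℤ.* (x ℤ.+ y′) ℤ.+ (+ 1 ℤ.+ (n ℤ.+ (n ℤ.+ + 0)) ℤ.- (+ 1 ℤ.+ n) ℤ.+ + 0 ℤ.+ k) ℤ.* x
      ℤ.+ ((+ 1 ℤ.+ n) ℤ.- + 0 ℤ.- (k ℤ.- + 1)) ℤ.* x′
  coeff₀ = solve-∀
Ψ≈insertOp n {P} P-deg (suc zero) k = coeff₁ (+ n) (+ k) (P 0 k) (P 1 k) (prev P 1 k)
  where
  coeff₁ : ∀ n k x y y′ →
    (n ℤ.+ k ℤ.+ + 1) ℤ.* y ℤ.+ (n ℤ.- (k ℤ.- + 1)) ℤ.* y′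
    ≡ + 0 ℤ.* (x ℤ.+ y′) ℤ.+ (+ 1 ℤ.+ (n ℤ.+ (n ℤ.+ + 0)) ℤ.- (+ 1 ℤ.+ n) ℤ.+ + 1 ℤ.+ k) ℤ.* y
      ℤ.+ ((+ 1 ℤ.+ n) ℤ.- + 1 ℤ.- (k ℤ.- + 1)) ℤ.* y′
  coeff₁ = solve-∀
Ψ≈insertOp n P-deg (suc (suc j)) k = sym (insertOp-degreeZ≤1 (suc (2 * n)) (suc n) z≤n P-deg j k)

-- Statistics of the insertions of a largest letter

insertions : ℕ → List ℕ → List (List ℕ)
insertions m []       = [ [ m ] ]
insertions m (y ∷ ys) = (m ∷ y ∷ ys) ∷ map (y ∷_) (insertions m ys)

desO-ascent : ∀ {y m} w → y < m → desO (y ∷ m ∷ w) ≡ desO (m ∷ w)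
desO-ascent {y} {m} w y<m with m <ᵇ y in m<ᵇy
... | false = refl
... | true  = contradiction (<ᵇ⇒< m y (subst T (sym m<ᵇy) _)) (<⇒≯ y<m)

desO-descent : ∀ {y m} w → y < m → desO (m ∷ y ∷ w) ≡ 𝟙 (odd y) + desO (y ∷ w)
desO-descent w y<m rewrite Equivalence.to T-≡ (<⇒<ᵇ y<m) = refl

-- Inserting m between y and z turns desO (y ∷ z ∷ w) = c + d into 𝟙 (odd z) + d,
-- where c = 1 exactly when y z is an odd descent; the remaining slots are those of z ∷ w.
first-slot : ∀ (z<y odd-z : Bool) (F : ℕ → Bool) l d o →
  let c = 𝟙 (z<y ∧ odd-z) in
  ⟦ F (𝟙 odd-z + d) ⟧
    ℤ.+ ((+ 1 ℤ.+ + l ℤ.+ + d ℤ.- + o) ℤ.* ⟦ F (c + d) ⟧ ℤ.+ (+ o ℤ.- + d) ℤ.* ⟦ F (c + suc d) ⟧)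
  ≡ (+ 1 ℤ.+ + suc l ℤ.+ + (c + d) ℤ.- + (𝟙 odd-z + o)) ℤ.* ⟦ F (c + d) ⟧
    ℤ.+ (+ (𝟙 odd-z + o) ℤ.- + (c + d)) ℤ.* ⟦ F (suc (c + d)) ⟧
first-slot false false F l d o = keep ⟦ F d ⟧ ⟦ F (suc d) ⟧ (+ l) (+ d) (+ o)
  where
  keep : ∀ X Y l d o →
    X ℤ.+ ((+ 1 ℤ.+ l ℤ.+ d ℤ.- o) ℤ.* X ℤ.+ (o ℤ.- d) ℤ.* Y)
    ≡ (+ 1 ℤ.+ (+ 1 ℤ.+ l) ℤ.+ d ℤ.- o) ℤ.* X ℤ.+ (o ℤ.- d) ℤ.* Y
  keep = solve-∀
first-slot true  false F l d o = first-slot false false F l d o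
first-slot false true  F l d o = rise ⟦ F d ⟧ ⟦ F (suc d) ⟧ (+ l) (+ d) (+ o)
  where
  rise : ∀ X Y l d o →
    Y ℤ.+ ((+ 1 ℤ.+ l ℤ.+ d ℤ.- o) ℤ.* X ℤ.+ (o ℤ.- d) ℤ.* Y)
    ≡ (+ 1 ℤ.+ (+ 1 ℤ.+ l) ℤ.+ d ℤ.- (+ 1 ℤ.+ o)) ℤ.* X ℤ.+ ((+ 1 ℤ.+ o) ℤ.- d) ℤ.* Y
  rise = solve-∀
first-slot true  true  F l d o = shift-descent ⟦ F (suc d) ⟧ ⟦ F (suc (suc d)) ⟧ (+ l) (+ d) (+ o)
  where
  shift-descent : ∀ X Y l d o →
    X ℤ.+ ((+ 1 ℤ.+ l ℤ.+ d ℤ.- o) ℤ.* X ℤ.+ (o ℤ.- d) ℤ.* Y)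
    ≡ (+ 1 ℤ.+ (+ 1 ℤ.+ l) ℤ.+ (+ 1 ℤ.+ d) ℤ.- (+ 1 ℤ.+ o)) ℤ.* X
      ℤ.+ ((+ 1 ℤ.+ o) ℤ.- (+ 1 ℤ.+ d)) ℤ.* Y
  shift-descent = solve-∀

count-desO-insertions : ∀ {m} y ys → y < m → All (_< m) ys → (F : ℕ → Bool) →
  + count (λ w → F (desO (y ∷ w))) (insertions m ys)
  ≡ (+ 1 ℤ.+ + length ys ℤ.+ + desO (y ∷ ys) ℤ.- + oddCount ys) ℤ.* ⟦ F (desO (y ∷ ys)) ⟧
    ℤ.+ (+ oddCount ys ℤ.- + desO (y ∷ ys)) ℤ.* ⟦ F (suc (desO (y ∷ ys))) ⟧
count-desO-insertions y [] y<m [] F =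
  trans (cong (ℤ._+ + 0) (trans (+𝟙≡⟦⟧ _) (cong (⟦_⟧ ∘ F) (desO-ascent [] y<m))))
        (one-slot ⟦ F 0 ⟧ ⟦ F 1 ⟧)
  where
  one-slot : ∀ X Y → X ℤ.+ + 0 ≡ (+ 1 ℤ.+ + 0 ℤ.+ + 0 ℤ.- + 0) ℤ.* X ℤ.+ (+ 0 ℤ.- + 0) ℤ.* Y
  one-slot = solve-∀
count-desO-insertions {m} y (z ∷ zs) y<m (z<m ∷ zs<m) F =
  trans (cong₂ ℤ._+_ slot-before-z later-slots)
        (first-slot (z <ᵇ y) (odd z) F (length zs) (desO (z ∷ zs)) (oddCount zs))
  where
  slot-before-z : + 𝟙 (F (desO (y ∷ m ∷ z ∷ zs))) ≡ ⟦ F (𝟙 (odd z) + desO (z ∷ zs)) ⟧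
  slot-before-z =
    trans (+𝟙≡⟦⟧ _) (cong (⟦_⟧ ∘ F) (trans (desO-ascent (z ∷ zs) y<m) (desO-descent zs z<m)))
  c d : ℕ
  c = 𝟙 ((z <ᵇ y) ∧ odd z)
  d = desO (z ∷ zs)
  later-slots : + count (λ w → F (desO (y ∷ w))) (map (z ∷_) (insertions m zs))
    ≡ (+ 1 ℤ.+ + length zs ℤ.+ + d ℤ.- + oddCount zs) ℤ.* ⟦ F (c + d) ⟧
      ℤ.+ (+ oddCount zs ℤ.- + d) ℤ.* ⟦ F (c + suc d) ⟧
  later-slots = trans (cong +_ (count-map (λ w → F (desO (y ∷ w))) (z ∷_) (insertions m zs)))
                      (count-desO-insertions z zs z<m zs<m (λ e → F (c + e)))

genPoly-insertions : ∀ {m} τ → All (_< m) τ →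
  genPoly (insertions m τ) ≈P insertOp (length τ) (oddCount τ) (𝟙 (odd m)) (mono (χfirstOdd τ) (desO τ))
genPoly-insertions {m} τ τ<m j k =
  trans (count-insertions τ τ<m)
        (sym (insertOp-mono (length τ) (oddCount τ) b (desO τ) (χfirstOdd≤1 τ) j k))
  where
  b : ℕ
  b = 𝟙 (odd m)
  count-insertions : ∀ τ → All (_< m) τ → genPoly (insertions m τ) j k
    ≡ mono b (χfirstOdd τ + desO τ) j k
      ℤ.+ keepWeight (length τ) (oddCount τ) (χfirstOdd τ) (desO τ) ℤ.* mono (χfirstOdd τ) (desO τ) j k
      ℤ.+ riseWeight (oddCount τ) (χfirstOdd τ) (suc (desO τ)) ℤ.* mono (χfirstOdd τ) (suc (desO τ)) j k
  count-insertions [] [] =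
    trans (genPoly-∷ [ m ] [] j k) (only-slot (mono b 0 j k) (mono 0 0 j k) (mono 0 1 j k))
    where
    only-slot : ∀ X Y Z →
      X ℤ.+ + 0 ≡ X ℤ.+ (+ 0 ℤ.- + 0 ℤ.+ + 0 ℤ.+ + 0) ℤ.* Y ℤ.+ (+ 0 ℤ.- + 0 ℤ.- (+ 1 ℤ.- + 1)) ℤ.* Z
    only-slot = solve-∀
  count-insertions (y ∷ ys) (y<m ∷ ys<m) = begin
    genPoly ((m ∷ y ∷ ys) ∷ map (y ∷_) (insertions m ys)) j k
      ≡⟨ genPoly-∷ (m ∷ y ∷ ys) (map (y ∷_) (insertions m ys)) j k ⟩
    mono b (desO (m ∷ y ∷ ys)) j k ℤ.+ genPoly (map (y ∷_) (insertions m ys)) j k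
      ≡⟨ cong₂ ℤ._+_ (cong (λ e → mono b e j k) (desO-descent ys y<m))
                     (cong +_ (count-map (λ σ → (χfirstOdd σ ≡ᵇ j) ∧ (desO σ ≡ᵇ k))
                                         (y ∷_) (insertions m ys))) ⟩
    mono b (a + d) j k ℤ.+ + count (λ w → F (desO (y ∷ w))) (insertions m ys)
      ≡⟨ cong (ℤ._+_ (mono b (a + d) j k)) (count-desO-insertions y ys y<m ys<m F) ⟩
    mono b (a + d) j k
      ℤ.+ ((+ 1 ℤ.+ + length ys ℤ.+ + d ℤ.- + oddCount ys) ℤ.* mono a d j k
           ℤ.+ (+ oddCount ys ℤ.- + d) ℤ.* mono a (suc d) j k)
      ≡⟨ regroup (mono b (a + d) j k) (mono a d j k) (mono a (suc d) j k)
                 (+ length ys) (+ a) (+ d) (+ oddCount ys) ⟩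
    mono b (a + d) j k
      ℤ.+ keepWeight (suc (length ys)) (a + oddCount ys) a d ℤ.* mono a d j k
      ℤ.+ riseWeight (a + oddCount ys) a (suc d) ℤ.* mono a (suc d) j k ∎
    where
    open ≡-Reasoning
    a d : ℕ
    a = 𝟙 (odd y)
    d = desO (y ∷ ys)
    F : ℕ → Bool
    F e = (a ≡ᵇ j) ∧ (e ≡ᵇ k)
    regroup : ∀ X Y Z l a d o →
      X ℤ.+ ((+ 1 ℤ.+ l ℤ.+ d ℤ.- o) ℤ.* Y ℤ.+ (o ℤ.- d) ℤ.* Z)
      ≡ X ℤ.+ ((+ 1 ℤ.+ l) ℤ.- (a ℤ.+ o) ℤ.+ a ℤ.+ d) ℤ.* Y
        ℤ.+ ((a ℤ.+ o) ℤ.- a ℤ.- ((+ 1 ℤ.+ d) ℤ.- + 1)) ℤ.* Z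
    regroup = solve-∀

-- Permutations as insertions of their largest letter

∈-oneTo⇒≤ : ∀ N {x} → x ∈ oneTo N → x ≤ N
∈-oneTo⇒≤ (suc N) x∈ with ∈-++⁻ (oneTo N) x∈
... | inj₁ x∈oneToN  = m≤n⇒m≤1+n (∈-oneTo⇒≤ N x∈oneToN)
... | inj₂ (here refl) = ≤-refl

oneTo-unique : ∀ N → Unique (oneTo N)
oneTo-unique zero    = []
oneTo-unique (suc N) = Unique.++⁺ (oneTo-unique N) ([] ∷ []) top-new
  where
  top-new : ∀ {x} → ¬ (x ∈ oneTo N × x ∈ [ suc N ])
  top-new (x∈ , here refl) = <-irrefl refl (∈-oneTo⇒≤ N x∈)

oneTo-suc↭ : ∀ N → oneTo (suc N) ↭ suc N ∷ oneTo N
oneTo-suc↭ N = ↭-sym (∷↭∷ʳ (suc N) (oneTo N))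

length-oneTo : ∀ N → length (oneTo N) ≡ N
length-oneTo zero    = refl
length-oneTo (suc N) = trans (↭-length (oneTo-suc↭ N)) (cong suc (length-oneTo N))

odd-2* : ∀ n → odd (2 * n) ≡ false
odd-2* zero    = refl
odd-2* (suc n) = trans (cong odd (*-suc 2 n)) (odd-2* n)

odd-1+2* : ∀ n → odd (suc (2 * n)) ≡ true
odd-1+2* zero    = refl
odd-1+2* (suc n) = trans (cong (odd ∘ suc) (*-suc 2 n)) (odd-1+2* n)

oddCount-oneTo-suc : ∀ N → oddCount (oneTo (suc N)) ≡ 𝟙 (odd (suc N)) + oddCount (oneTo N)
oddCount-oneTo-suc N = oddCount-↭ (oneTo-suc↭ N)

oddCount-oneTo-2* : ∀ n → oddCount (oneTo (2 * n)) ≡ n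
oddCount-oneTo-1+2* : ∀ n → oddCount (oneTo (suc (2 * n))) ≡ suc n

oddCount-oneTo-2* zero = refl
oddCount-oneTo-2* (suc n) =
  trans (cong (oddCount ∘ oneTo) (*-suc 2 n))
        (trans (oddCount-oneTo-suc (suc (2 * n))) (cong₂ _+_ (cong 𝟙 (odd-2* n)) (oddCount-oneTo-1+2* n)))

oddCount-oneTo-1+2* n =
  trans (oddCount-oneTo-suc (2 * n)) (cong₂ _+_ (cong 𝟙 (odd-1+2* n)) (oddCount-oneTo-2* n))

unique⊆⇒length≤ : ∀ {xs ys : List ℕ} → Unique xs → xs ⊆ ys → length xs ≤ length ys
unique⊆⇒length≤ {[]}     _          _      = z≤n
unique⊆⇒length≤ {x ∷ xs} (x∉ ∷ uxs) xs⊆ys with ∈-∃++ (xs⊆ys (here refl))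
... | α , β , refl = begin
  suc (length xs)          ≤⟨ s≤s (unique⊆⇒length≤ uxs xs⊆α++β) ⟩
  suc (length (α ++ β))    ≡⟨ ↭-length (shift x α β) ⟨
  length (α ++ x ∷ β)      ∎
  where
  open ≤-Reasoning
  xs⊆α++β : xs ⊆ α ++ β
  xs⊆α++β {v} v∈xs with ∈-resp-↭ (shift x α β) (xs⊆ys (there v∈xs))
  ... | here v≡x    = contradiction (sym v≡x) (All.lookup x∉ v∈xs)
  ... | there v∈α++β = v∈α++β

unique⊆⇒⊇ : ∀ {xs ys : List ℕ} → Unique xs → xs ⊆ ys → length ys ≤ length xs → ys ⊆ xs
unique⊆⇒⊇ {xs} {ys} uxs xs⊆ys ys≤xs {v} v∈ys with v ∈? xs
... | yes v∈xs = v∈xs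
... | no  v∉xs =
  contradiction (≤-trans (unique⊆⇒length≤ (¬Any⇒All¬ xs v∉xs ∷ uxs) v∷xs⊆ys) ys≤xs) (<-irrefl refl)
  where
  v∷xs⊆ys : v ∷ xs ⊆ ys
  v∷xs⊆ys (here refl)   = v∈ys
  v∷xs⊆ys (there w∈xs) = xs⊆ys w∈xs

unique⊆⇒↭ : ∀ {xs ys : List ℕ} → Unique xs → Unique ys → xs ⊆ ys → length ys ≤ length xs → xs ↭ ys
unique⊆⇒↭ uxs uys xs⊆ys ys≤xs =
  ∼bag⇒↭ (unique∧set⇒bag uxs uys (mk⇔ xs⊆ys (unique⊆⇒⊇ uxs xs⊆ys ys≤xs)))

concatMap-unique : ∀ {A B : Set} {f : A → List B} {xs} → Unique xs →
  (∀ {x} → x ∈ xs → Unique (f x)) →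
  (∀ {x y v} → x ∈ xs → y ∈ xs → v ∈ f x → v ∈ f y → x ≡ y) →
  Unique (concatMap f xs)
concatMap-unique {f = f} {[]}     []         _      _    = []
concatMap-unique {f = f} {x ∷ xs} (x∉ ∷ uxs) unique-f same =
  Unique.++⁺ (unique-f (here refl))
             (concatMap-unique uxs (unique-f ∘ there) (λ x∈ y∈ → same (there x∈) (there y∈)))
             disjoint
  where
  disjoint : ∀ {v} → ¬ (v ∈ f x × v ∈ concatMap f xs)
  disjoint (v∈fx , v∈rest) with find (∈-concatMap⁻ f {xs = xs} v∈rest)
  ... | y , y∈xs , v∈fy = All.lookup x∉ y∈xs (same (here refl) (there y∈xs) v∈fx v∈fy)

∈-words⁻ : ∀ A m {σ} → σ ∈ words A m → length σ ≡ m × All (_∈ A) σ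
∈-words⁻ A zero    (here refl) = refl , []
∈-words⁻ A (suc m) σ∈ with find (∈-concatMap⁻ (λ a → map (a ∷_) (words A m)) {xs = A} σ∈)
... | a , a∈A , σ∈a∷words with ∈-map⁻ (a ∷_) σ∈a∷words
... | w , w∈words , refl with ∈-words⁻ A m w∈words
... | length≡m , w⊆A = cong suc length≡m , a∈A ∷ w⊆A

∈-words⁺ : ∀ A m {σ} → length σ ≡ m → All (_∈ A) σ → σ ∈ words A m
∈-words⁺ A zero    {[]}    refl []             = here refl
∈-words⁺ A (suc m) {a ∷ σ} length≡ (a∈A ∷ σ⊆A) =
  ∈-concatMap⁺ (λ a → map (a ∷_) (words A m)) {xs = A}
    (lose a∈A (∈-map⁺ (a ∷_) (∈-words⁺ A m (suc-injective length≡) σ⊆A)))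

words-unique : ∀ {A} → Unique A → ∀ m → Unique (words A m)
words-unique uA zero    = [] ∷ []
words-unique {A} uA (suc m) =
  concatMap-unique uA (λ _ → Unique.map⁺ ∷-injectiveʳ (words-unique uA m)) same-head
  where
  same-head : ∀ {a b v} → a ∈ A → b ∈ A →
    v ∈ map (a ∷_) (words A m) → v ∈ map (b ∷_) (words A m) → a ≡ b
  same-head _ _ v∈a∷ v∈b∷ with ∈-map⁻ _ v∈a∷ | ∈-map⁻ _ v∈b∷
  ... | _ , _ , refl | _ , _ , refl = refl

S-unique : ∀ N → Unique (S N)
S-unique N = Unique.filter⁺ unique? (words-unique (oneTo-unique N) N)

∈-S⇒↭ : ∀ N {σ} → σ ∈ S N → σ ↭ oneTo N
∈-S⇒↭ N {σ} σ∈S with ∈-filter⁻ unique? {xs = words (oneTo N) N} σ∈S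
... | σ∈words , uσ with ∈-words⁻ (oneTo N) N σ∈words
... | length≡N , σ⊆oneTo =
  unique⊆⇒↭ uσ (oneTo-unique N) (All.lookup σ⊆oneTo) (≤-reflexive (trans (length-oneTo N) (sym length≡N)))

↭⇒∈-S : ∀ N {σ} → σ ↭ oneTo N → σ ∈ S N
↭⇒∈-S N σ↭ =
  ∈-filter⁺ unique?
    (∈-words⁺ (oneTo N) N (trans (↭-length σ↭) (length-oneTo N)) (All.tabulate (∈-resp-↭ σ↭)))
    (Unique-resp-↭ (↭⇒↭ₛ (↭-sym σ↭)) (oneTo-unique N))

∈-S⇒< : ∀ N {τ} → τ ∈ S N → All (_< suc N) τ
∈-S⇒< N τ∈S = All.tabulate (λ x∈τ → s≤s (∈-oneTo⇒≤ N (∈-resp-↭ (∈-S⇒↭ N τ∈S) x∈τ)))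

insertions-↭ : ∀ {m σ} τ → σ ∈ insertions m τ → σ ↭ m ∷ τ
insertions-↭ []       (here refl) = ↭-refl
insertions-↭ (y ∷ ys) (here refl) = ↭-refl
insertions-↭ {m} (y ∷ ys) (there σ∈) with ∈-map⁻ (y ∷_) σ∈
... | w , w∈ , refl = ↭-trans (↭-prep y (insertions-↭ ys w∈)) (↭-swap y m ↭-refl)

∈-insertions : ∀ m α β → α ++ m ∷ β ∈ insertions m (α ++ β)
∈-insertions m []      []      = here refl
∈-insertions m []      (b ∷ β) = here refl
∈-insertions m (a ∷ α) β       = there (∈-map⁺ (a ∷_) (∈-insertions m α β))

insertions-unique : ∀ {m} τ → m ∉ τ → Unique (insertions m τ)
insertions-unique []       _   = [] ∷ []
insertions-unique {m} (y ∷ ys) m∉ =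
  All.tabulate front≢ ∷ Unique.map⁺ ∷-injectiveʳ (insertions-unique ys (m∉ ∘ there))
  where
  front≢ : ∀ {σ} → σ ∈ map (y ∷_) (insertions m ys) → m ∷ y ∷ ys ≢ σ
  front≢ σ∈ eq with ∈-map⁻ (y ∷_) σ∈
  ... | _ , _ , refl = m∉ (here (∷-injectiveˡ eq))

erase : ℕ → List ℕ → List ℕ
erase m = filter (λ x → ¬? (x ≟ m))

erase-front : ∀ {m} τ → m ∉ τ → erase m (m ∷ τ) ≡ τ
erase-front {m} τ m∉ =
  trans (filter-reject (λ x → ¬? (x ≟ m)) (λ m≢m → m≢m refl))
        (filter-all (λ x → ¬? (x ≟ m)) (All.map (_∘ sym) (¬Any⇒All¬ τ m∉)))

erase-insertions : ∀ {m σ} τ → m ∉ τ → σ ∈ insertions m τ → erase m σ ≡ τ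
erase-insertions {m} []       m∉ (here refl) = erase-front [] m∉
erase-insertions {m} (y ∷ ys) m∉ (here refl) = erase-front (y ∷ ys) m∉
erase-insertions {m} (y ∷ ys) m∉ (there σ∈) with ∈-map⁻ (y ∷_) σ∈
... | w , w∈ , refl =
  trans (filter-accept (λ x → ¬? (x ≟ m)) (λ y≡m → m∉ (here (sym y≡m))))
        (cong (y ∷_) (erase-insertions ys (m∉ ∘ there) w∈))

S-suc↭ : ∀ N → S (suc N) ↭ concatMap (insertions (suc N)) (S N)
S-suc↭ N =
  ∼bag⇒↭ (unique∧set⇒bag (S-unique (suc N)) insertions-disjoint (mk⇔ remove-top insert-top))
  where
  top∉ : ∀ {τ} → τ ∈ S N → suc N ∉ τ
  top∉ τ∈S top∈τ = <-irrefl refl (All.lookup (∈-S⇒< N τ∈S) top∈τ)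
  insertions-disjoint : Unique (concatMap (insertions (suc N)) (S N))
  insertions-disjoint = concatMap-unique (S-unique N) (λ τ∈S → insertions-unique _ (top∉ τ∈S))
    (λ τ∈S τ′∈S σ∈ σ∈′ →
      trans (sym (erase-insertions _ (top∉ τ∈S) σ∈)) (erase-insertions _ (top∉ τ′∈S) σ∈′))
  top∈oneTo : suc N ∈ oneTo (suc N)
  top∈oneTo = ∈-++⁺ʳ (oneTo N) (here refl)
  remove-top : ∀ {σ} → σ ∈ S (suc N) → σ ∈ concatMap (insertions (suc N)) (S N)
  remove-top σ∈S with ∈-∃++ (∈-resp-↭ (↭-sym (∈-S⇒↭ (suc N) σ∈S)) top∈oneTo)
  ... | α , β , refl =
    ∈-concatMap⁺ (insertions (suc N)) {xs = S N} (lose (↭⇒∈-S N α++β↭) (∈-insertions (suc N) α β))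
    where
    α++β↭ : α ++ β ↭ oneTo N
    α++β↭ = ↭-trans (drop-mid α (oneTo N) (∈-S⇒↭ (suc N) σ∈S)) (↭-reflexive (++-identityʳ (oneTo N)))
  insert-top : ∀ {σ} → σ ∈ concatMap (insertions (suc N)) (S N) → σ ∈ S (suc N)
  insert-top σ∈ with find (∈-concatMap⁻ (insertions (suc N)) {xs = S N} σ∈)
  ... | τ , τ∈S , σ∈ins =
    ↭⇒∈-S (suc N) (↭-trans (insertions-↭ τ σ∈ins)
                           (↭-trans (↭-prep (suc N) (∈-S⇒↭ N τ∈S)) (↭-sym (oneTo-suc↭ N))))

Q-suc : ∀ N → Q (suc N) ≈P insertOp N (oddCount (oneTo N)) (𝟙 (odd (suc N))) (Q N)
Q-suc N j k =
  trans (genPoly-↭ (S-suc↭ N) j k)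
        (genPoly-concatMap (insertOp-additive N o b) (insertions (suc N)) (S N) insert-into j k)
  where
  o b : ℕ
  o = oddCount (oneTo N)
  b = 𝟙 (odd (suc N))
  insert-into : ∀ {τ} → τ ∈ S N →
    genPoly (insertions (suc N) τ) ≈P insertOp N o b (mono (χfirstOdd τ) (desO τ))
  insert-into {τ} τ∈S j k =
    trans (genPoly-insertions τ (∈-S⇒< N τ∈S) j k)
          (cong₂ (λ l o → insertOp l o b (mono (χfirstOdd τ) (desO τ)) j k)
                 (trans (↭-length τ↭) (length-oneTo N)) (oddCount-↭ τ↭))
    where
    τ↭ : τ ↭ oneTo N
    τ↭ = ∈-S⇒↭ N τ∈S

Q₁ : (j k : ℕ) → Q 1 j k ≡ zP j k
Q₁ zero          k       = refl
Q₁ (suc zero)    zero    = refl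
Q₁ (suc zero)    (suc k) = refl
Q₁ (suc (suc j)) k       = refl

Q₂ : (j k : ℕ) → Q 2 j k ≡ (zP +P xP) j k
Q₂ zero          zero          = refl
Q₂ zero          (suc zero)    = refl
Q₂ zero          (suc (suc k)) = refl
Q₂ (suc zero)    zero          = refl
Q₂ (suc zero)    (suc zero)    = refl
Q₂ (suc zero)    (suc (suc k)) = refl
Q₂ (suc (suc j)) k             = refl

-- The recursions also hold for n = 0.
Q-odd : (n : ℕ) → 1 ≤ n → (j k : ℕ) → Q (2 * n + 1) j k ≡ Φ n (Q (2 * n)) j k
Q-odd n _ j k rewrite +-comm (2 * n) 1 = begin
  Q (suc (2 * n)) j k
    ≡⟨ Q-suc (2 * n) j k ⟩
  insertOp (2 * n) (oddCount (oneTo (2 * n))) (𝟙 (odd (suc (2 * n)))) (Q (2 * n)) j k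
    ≡⟨ cong₂ (λ o b → insertOp (2 * n) o b (Q (2 * n)) j k)
             (oddCount-oneTo-2* n) (cong 𝟙 (odd-1+2* n)) ⟩
  insertOp (2 * n) n 1 (Q (2 * n)) j k
    ≡⟨ Φ≈insertOp n (genPoly-degreeZ≤1 (S (2 * n))) j k ⟨
  Φ n (Q (2 * n)) j k ∎
  where open ≡-Reasoning

Q-even : (n : ℕ) → 1 ≤ n → (j k : ℕ) → Q (2 * n + 2) j k ≡ Ψ n (Q (2 * n + 1)) j k
Q-even n _ j k rewrite +-comm (2 * n) 2 | +-comm (2 * n) 1 = begin
  Q (suc (suc (2 * n))) j k
    ≡⟨ Q-suc (suc (2 * n)) j k ⟩
  insertOp (suc (2 * n)) (oddCount (oneTo (suc (2 * n)))) (𝟙 (odd (2 * n))) (Q (suc (2 * n))) j k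
    ≡⟨ cong₂ (λ o b → insertOp (suc (2 * n)) o b (Q (suc (2 * n))) j k)
             (oddCount-oneTo-1+2* n) (cong 𝟙 (odd-2* n)) ⟩
  insertOp (suc (2 * n)) (suc n) 0 (Q (suc (2 * n))) j k
    ≡⟨ Ψ≈insertOp n (genPoly-degreeZ≤1 (S (suc (2 * n)))) j k ⟨
  Ψ n (Q (suc (2 * n))) j k ∎
  where open ≡-Reasoning

theorem5p1 : ((j k : ℕ) → Q 1 j k ≡ zP j k)
    × ((j k : ℕ) → Q 2 j k ≡ (zP +P xP) j k)
    × ((n : ℕ) → 1 ≤ n → (j k : ℕ) → Q (2 * n + 1) j k ≡ Φ n (Q (2 * n)) j k)
    × ((n : ℕ) → 1 ≤ n → (j k : ℕ) → Q (2 * n + 2) j k ≡ Ψ n (Q (2 * n + 1)) j k)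
theorem5p1 = Q₁ , Q₂ , Q-odd , Q-even
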